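{- Let $j>0$ be an integer and $n_0$ an even integer, and let $S$ be the set of even integers $n$ with $n\equiv n_0 \pmod{2^{j-1}}$. (a) For $n,n'\in S$: the orbit of the constant sequence $1^{2j-1}$ under the permutation $u\mapsto C_{1,n}(1,u)$ of $\{1,n\}^{2j-1}$ has length $2^j$ if and only if the orbit of $1^{2j-1}$ under $u\mapsto C_{1,n'}(1,u)$ of $\{1,n'\}^{2j-1}$ has length $2^j$. (b) For an even integer $n$, let $P(n)$ be the statement: with $v=(n,-1)$, for each of the two sequences $t=(-1)v^{j-1}$ and $t=v^{j-1}(n)$ (both of length $2j-1$, where $v^{j-1}$ is the concatenation of $j-1$ copies of $v$), the orbit of $t$ under the permutation $u\mapsto C_{ -1,n}(-1,u)$ of $\{ -1,n\}^{2j-1}$ has length $2^j$. Then for $n,n'\in S$, $P(n)$ holds if and only if $P(n')$ holds.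
   Context: Let $m\neq n$ be integers (possibly nonpositive). For $k\ge 0$, $\{m,n\}^k$ is the set of length-$k$ sequences with values in $\{m,n\}$. For an integer $x$ and $t\in\{m,n\}^k$, define $C_{m,n}(x,t)\in\{m,n\}^k$ by induction on $k$: if $k=0$, $C_{m,n}(x,t)$ is the empty sequence; otherwise writing $t=(t_1)t'$ with $t'\in\{m,n\}^{k-1}$, set $C_{m,n}(x,t)=(m+n-t_1)\,\big(C_{m,n}(t_1,-)\big)^x(t')$, where $C_{m,n}(t_1,-)$ is the (inductively known to be bijective) map $u\mapsto C_{m,n}(t_1,u)$ on $\{m,n\}^{k-1}$ and the $x$-th power is taken in the group of permutations (so negative $x$ uses the inverse and $x=0$ gives the identity). Each $C_{m,n}(x,-)$ is then a length-preserving bijection. For a finite sequence $s=(s_1,\dots,s_r)$ of integers, $C_{m,n}(s,t)=C_{m,n}(s_r,\cdots C_{m,n}(s_2,C_{m,n}(s_1,t))\cdots)$. (For positive integers $m,n,x$ this agrees with the definition of $C_{m,n}$ via iterated run-length expansion: the $i$-th term of $C_{m,n}(s,t)$ is $m+n$ minus the last term of the unique $\{m,n\}$-valued sequence obtained by expanding $s$ via inverse run-length encoding successively with starting terms $t_1,\dots,t_i$.) -}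

module Defs where

open import Data.Bool using (Bool; true; false; not)
open import Data.Nat as ℕ using (ℕ; zero; suc)
open import Data.Integer as ℤ using (ℤ; +_; -[1+_]; -_)
open import Data.Vec using (Vec; []; _∷_)
open import Data.Product using (_×_)
open import Relation.Binary.PropositionalEquality using (_≡_; _≢_)

-- A sequence in {m,n}^k is encoded as a Vec Bool k:
-- false stands for the value m and true for the value n (requires m ≠ n).
val : ℤ → ℤ → Bool → ℤ
val m n false = m
val m n true  = n

iter : {A : Set} → (A → A) → ℕ → A → A
iter f zero    a = a
iter f (suc c) a = f (iter f c a)

mutual
  C : (m n : ℤ) (k : ℕ) → ℤ → Vec Bool k → Vec Bool k
  C m n zero    x []      = []
  -- first term m+n-t₁ is the other element of {m,n}
  C m n (suc k) x (b ∷ t) = not b ∷ Cpow m n k (val m n b) x t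

  Cinv : (m n : ℤ) (k : ℕ) → ℤ → Vec Bool k → Vec Bool k
  Cinv m n zero    x []      = []
  Cinv m n (suc k) x (c ∷ u) = not c ∷ Cpow m n k (val m n (not c)) (- x) u

  Cpow : (m n : ℤ) (k : ℕ) → ℤ → ℤ → Vec Bool k → Vec Bool k
  Cpow m n k y (+ c)     t = iter (C m n k y) c t
  Cpow m n k y -[1+ c ]  t = iter (Cinv m n k y) (suc c) t

OrbitLength : {A : Set} → (A → A) → A → ℕ → Set
OrbitLength f a p =
  (0 ℕ.< p) × (iter f p a ≡ a) × (∀ q → 0 ℕ.< q → q ℕ.< p → iter f q a ≢ a)

-- double i = 2i ; sequences of length 2j-1 have length suc (double (j ∸ 1))
double : ℕ → ℕ
double zero    = zero
double (suc i) = suc (suc (double i))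

constM : (i : ℕ) → Vec Bool (suc (double i))
constM zero    = false ∷ []
constM (suc i) = false ∷ false ∷ constM i

vpow : (i : ℕ) → Vec Bool (double i)
vpow zero    = []
vpow (suc i) = true ∷ false ∷ vpow i

seqA : (i : ℕ) → Vec Bool (suc (double i))
seqA i = false ∷ vpow i

seqB : (i : ℕ) → Vec Bool (suc (double i))
seqB zero    = true ∷ []
seqB (suc i) = true ∷ false ∷ seqB i

P : ℕ → ℤ → Set
P j n = OrbitLength (C (ℤ.- (+ 1)) n (suc (double (j ℕ.∸ 1))) (ℤ.- (+ 1))) (seqA (j ℕ.∸ 1)) (2 ℕ.^ j)
      × OrbitLength (C (ℤ.- (+ 1)) n (suc (double (j ℕ.∸ 1))) (ℤ.- (+ 1))) (seqB (j ℕ.∸ 1)) (2 ℕ.^ j)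

-- C_{m,n}(x,-) on {m,n}^k is the automorphism of the binary tree of depth k with portrait
-- node true (C(m,-)^x) (C(n,-)^x), and every such portrait is balanced: the two children of
-- each vertex carry the same root label.  Balanced automorphisms of depth k have order dividing
-- 2^⌈k/2⌉, so C(x,-) on length k + 1 depends on x only modulo 2^⌈k/2⌉.  By induction on k,
-- C_{m,n}(x,-) on length k + 1 then depends on n only modulo 2^⌊k/2⌋; for k = 2j - 2 this is
-- 2^(j-1), so for n, n' ∈ S the permutations in (a) and in (b) coincide.
module Submission where

open import Defs
open import Data.Nat as ℕ using (ℕ)
open import Data.Integer as ℤ using (ℤ; +_; _-_)
open import Data.Integer.Divisibility using (_∣_)
open import Data.Product using (_×_)
open import Function.Bundles using (_⇔_)

open import Data.Bool using (Bool; true; false; not; _xor_)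
open import Data.Bool.Properties using (not-involutive; xor-same)
open import Data.Integer using (-[1+_]; -_)
open import Data.Integer.Properties using (neg-involutive; pos-*; +-identityʳ)
import Data.Integer.Divisibility.Signed as Signed
open import Data.Integer.Tactic.RingSolver using (solve-∀)
open import Data.Nat using (zero; suc; _+_; _*_; _^_; _≤_; ⌊_/2⌋; ⌈_/2⌉)
open import Data.Nat.Divisibility as ℕ∣ using (divides; n∣m*n)
open import Data.Nat.Properties
  using (+-comm; *-comm; ^-distribˡ-+-*; m≤n⇒∃[o]m+o≡n; n≤1+n; ⌈n/2⌉-mono; ⌊n/2⌋≤⌈n/2⌉)
open import Data.Product using (_,_)
open import Data.Product.Function.NonDependent.Propositional using (_×-⇔_)
open import Data.Unit using (⊤; tt)
open import Data.Vec using (Vec; []; _∷_)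
open import Function.Bundles using (mk⇔)
open import Relation.Binary.PropositionalEquality
open ≡-Reasoning

module _ {A : Set} where

  iter-cong : {f g : A → A} → (∀ a → f a ≡ g a) → ∀ c a → iter f c a ≡ iter g c a
  iter-cong     f≗g zero    a = refl
  iter-cong {f} f≗g (suc c) a = trans (cong f (iter-cong f≗g c a)) (f≗g _)

  iter-+ : (f : A → A) → ∀ b c a → iter f (b + c) a ≡ iter f b (iter f c a)
  iter-+ f zero    c a = refl
  iter-+ f (suc b) c a = cong f (iter-+ f b c a)

  iter-* : (f : A → A) → ∀ b c a → iter f (b * c) a ≡ iter (iter f c) b a
  iter-* f zero    c a = refl
  iter-* f (suc b) c a = trans (iter-+ f c (b * c) a) (cong (iter f c) (iter-* f b c a))

  iter-fixed : {f : A → A} → (∀ a → f a ≡ a) → ∀ c a → iter f c a ≡ a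
  iter-fixed f≗id zero    a = refl
  iter-fixed f≗id (suc c) a = trans (f≗id _) (iter-fixed f≗id c a)

  iter-∣ : {f : A → A} {N M : ℕ} → (∀ a → iter f N a ≡ a) → N ℕ∣.∣ M → ∀ a → iter f M a ≡ a
  iter-∣ {f} {N} fᴺ≗id (divides q refl) a = trans (iter-* f q N a) (iter-fixed fᴺ≗id q a)

  iter-suc-inner : (f : A → A) → ∀ c a → iter f (suc c) a ≡ iter f c (f a)
  iter-suc-inner f zero    a = refl
  iter-suc-inner f (suc c) a = cong f (iter-suc-inner f c a)

  iter-cancel : (f g : A → A) → (∀ a → f (g a) ≡ a) → ∀ c a → iter f c (iter g c a) ≡ a
  iter-cancel f g f∘g≗id zero    a = refl
  iter-cancel f g f∘g≗id (suc c) a = begin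
    iter f (suc c) (g (iter g c a)) ≡⟨ iter-suc-inner f c _ ⟩
    iter f c (f (g (iter g c a)))   ≡⟨ cong (iter f c) (f∘g≗id _) ⟩
    iter f c (iter g c a)           ≡⟨ iter-cancel f g f∘g≗id c a ⟩
    a                               ∎

iter-fix-head : ∀ {A : Set} {k} {f : Vec A (suc k) → Vec A (suc k)} {h : Vec A k → Vec A k} b →
  (∀ t → f (b ∷ t) ≡ b ∷ h t) → ∀ c t → iter f c (b ∷ t) ≡ b ∷ iter h c t
iter-fix-head         b f≈h zero    t = refl
iter-fix-head {f = f} b f≈h (suc c) t = trans (cong f (iter-fix-head b f≈h c t)) (f≈h _)

module _ {A : Set} (g g⁻¹ : A → A) where

  zpow : ℤ → A → A
  zpow (+ c)    = iter g c
  zpow -[1+ c ] = iter g⁻¹ (suc c)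

  module _ (g∘g⁻¹≗id : ∀ a → g (g⁻¹ a) ≡ a) where

    zpow-suc : ∀ x a → zpow (x ℤ.+ + 1) a ≡ g (zpow x a)
    zpow-suc (+ c)        a = cong (λ c → iter g c a) (+-comm c 1)
    zpow-suc -[1+ zero ]  a = sym (g∘g⁻¹≗id a)
    zpow-suc -[1+ suc c ] a = sym (g∘g⁻¹≗id _)

    zpow-+ : ∀ x c a → zpow (x ℤ.+ + c) a ≡ iter g c (zpow x a)
    zpow-+ x zero    a = cong (λ y → zpow y a) (+-identityʳ x)
    zpow-+ x (suc c) a = begin
      zpow (x ℤ.+ + suc c) a          ≡⟨ cong (λ y → zpow y a) (shift-one x (+ c)) ⟩
      zpow ((x ℤ.+ + c) ℤ.+ + 1) a    ≡⟨ zpow-suc (x ℤ.+ + c) a ⟩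
      g (zpow (x ℤ.+ + c) a)          ≡⟨ cong g (zpow-+ x c a) ⟩
      iter g (suc c) (zpow x a)       ∎
      where
      shift-one : ∀ x y → x ℤ.+ (+ 1 ℤ.+ y) ≡ (x ℤ.+ y) ℤ.+ + 1
      shift-one = solve-∀

    zpow-+-multiple : ∀ {N} → (∀ a → iter g N a ≡ a) →
      ∀ x c a → zpow (x ℤ.+ + c ℤ.* + N) a ≡ zpow x a
    zpow-+-multiple {N} gᴺ≗id x c a = begin
      zpow (x ℤ.+ + c ℤ.* + N) a ≡⟨ cong (λ y → zpow (x ℤ.+ y) a) (sym (pos-* c N)) ⟩
      zpow (x ℤ.+ + (c * N)) a   ≡⟨ zpow-+ x (c * N) a ⟩
      iter g (c * N) (zpow x a)  ≡⟨ iter-∣ gᴺ≗id (n∣m*n c) _ ⟩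
      zpow x a                   ∎

    zpow-periodic : ∀ {N} → (∀ a → iter g N a ≡ a) →
      ∀ {x y} → + N ∣ y - x → ∀ a → zpow y a ≡ zpow x a
    zpow-periodic {N} gᴺ≗id {x} {y} N∣y-x a with Signed.∣ᵤ⇒∣ N∣y-x
    ... | Signed.divides q y-x≡qN = trans (cong (λ z → zpow z a) y≡x+qN) (shift q)
      where
      y≡x+[y-x] : ∀ y x → y ≡ x ℤ.+ (y - x)
      y≡x+[y-x] = solve-∀
      y≡x+qN : y ≡ x ℤ.+ q ℤ.* + N
      y≡x+qN = trans (y≡x+[y-x] y x) (cong (λ z → x ℤ.+ z) y-x≡qN)
      x≡x+qN-qN : ∀ x q N → x ≡ (x ℤ.+ q ℤ.* N) ℤ.+ (- q) ℤ.* N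
      x≡x+qN-qN = solve-∀
      shift : ∀ q → zpow (x ℤ.+ q ℤ.* + N) a ≡ zpow x a
      shift (+ c)    = zpow-+-multiple gᴺ≗id x c a
      shift -[1+ c ] = sym (begin
        zpow x a                                    ≡⟨ cong (λ z → zpow z a) (x≡x+qN-qN x -[1+ c ] (+ N)) ⟩
        zpow (x′ ℤ.+ + suc c ℤ.* + N) a             ≡⟨ zpow-+-multiple gᴺ≗id x′ (suc c) a ⟩
        zpow x′ a                                   ∎)
        where
        x′ : ℤ
        x′ = x ℤ.+ -[1+ c ] ℤ.* + N

    zpow-cancel : (∀ a → g⁻¹ (g a) ≡ a) → ∀ x a → zpow x (zpow (- x) a) ≡ a
    zpow-cancel g⁻¹∘g≗id (+ zero)  a = refl
    zpow-cancel g⁻¹∘g≗id (+ suc c) a = iter-cancel g g⁻¹ g∘g⁻¹≗id (suc c) a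
    zpow-cancel g⁻¹∘g≗id -[1+ c ]  a = iter-cancel g⁻¹ g g⁻¹∘g≗id (suc c) a

-- Automorphisms of the binary tree, given by their portraits

data TreeAut : ℕ → Set where
  leaf : TreeAut 0
  node : ∀ {k} → Bool → TreeAut k → TreeAut k → TreeAut (suc k)

apply : ∀ {k} → TreeAut k → Vec Bool k → Vec Bool k
apply leaf           []          = []
apply (node s g₀ g₁) (false ∷ t) = s ∷ apply g₀ t
apply (node s g₀ g₁) (true ∷ t)  = not s ∷ apply g₁ t

root : ∀ {k} → TreeAut k → Bool
root leaf         = false
root (node s _ _) = s

child : ∀ {k} → TreeAut (suc k) → Bool → TreeAut k
child (node _ g₀ _) false = g₀
child (node _ _ g₁) true  = g₁

idᵀ : ∀ k → TreeAut k
idᵀ zero    = leaf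
idᵀ (suc k) = node false (idᵀ k) (idᵀ k)

infixr 9 _∘ᵀ_

_∘ᵀ_ : ∀ {k} → TreeAut k → TreeAut k → TreeAut k
leaf         ∘ᵀ leaf             = leaf
node r g₀ g₁ ∘ᵀ node false f₀ f₁ = node r (g₀ ∘ᵀ f₀) (g₁ ∘ᵀ f₁)
node r g₀ g₁ ∘ᵀ node true  f₀ f₁ = node (not r) (g₁ ∘ᵀ f₀) (g₀ ∘ᵀ f₁)

invᵀ : ∀ {k} → TreeAut k → TreeAut k
invᵀ leaf               = leaf
invᵀ (node false g₀ g₁) = node false (invᵀ g₀) (invᵀ g₁)
invᵀ (node true  g₀ g₁) = node true  (invᵀ g₁) (invᵀ g₀)

powᵀ : ∀ {k} → TreeAut k → ℕ → TreeAut k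
powᵀ {k} g zero    = idᵀ k
powᵀ     g (suc c) = g ∘ᵀ powᵀ g c

zpowᵀ : ∀ {k} → TreeAut k → ℤ → TreeAut k
zpowᵀ g (+ c)    = powᵀ g c
zpowᵀ g -[1+ c ] = powᵀ (invᵀ g) (suc c)

apply-idᵀ : ∀ k t → apply (idᵀ k) t ≡ t
apply-idᵀ zero    []          = refl
apply-idᵀ (suc k) (false ∷ t) = cong (false ∷_) (apply-idᵀ k t)
apply-idᵀ (suc k) (true ∷ t)  = cong (true ∷_) (apply-idᵀ k t)

apply-∘ᵀ : ∀ {k} (g f : TreeAut k) t → apply (g ∘ᵀ f) t ≡ apply g (apply f t)
apply-∘ᵀ leaf           leaf               []          = refl
apply-∘ᵀ (node r g₀ g₁) (node false f₀ f₁) (false ∷ t) = cong (r ∷_) (apply-∘ᵀ g₀ f₀ t)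
apply-∘ᵀ (node r g₀ g₁) (node false f₀ f₁) (true ∷ t)  = cong (not r ∷_) (apply-∘ᵀ g₁ f₁ t)
apply-∘ᵀ (node r g₀ g₁) (node true  f₀ f₁) (false ∷ t) = cong (not r ∷_) (apply-∘ᵀ g₁ f₀ t)
apply-∘ᵀ (node r g₀ g₁) (node true  f₀ f₁) (true ∷ t)  = cong₂ _∷_ (not-involutive r) (apply-∘ᵀ g₀ f₁ t)

apply-powᵀ : ∀ {k} (g : TreeAut k) c t → apply (powᵀ g c) t ≡ iter (apply g) c t
apply-powᵀ g zero    t = apply-idᵀ _ t
apply-powᵀ g (suc c) t = trans (apply-∘ᵀ g (powᵀ g c) t) (cong (apply g) (apply-powᵀ g c t))

apply-invᵀ-apply : ∀ {k} (g : TreeAut k) t → apply (invᵀ g) (apply g t) ≡ t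
apply-invᵀ-apply leaf               []          = refl
apply-invᵀ-apply (node false g₀ g₁) (false ∷ t) = cong (false ∷_) (apply-invᵀ-apply g₀ t)
apply-invᵀ-apply (node false g₀ g₁) (true ∷ t)  = cong (true ∷_) (apply-invᵀ-apply g₁ t)
apply-invᵀ-apply (node true  g₀ g₁) (false ∷ t) = cong (false ∷_) (apply-invᵀ-apply g₀ t)
apply-invᵀ-apply (node true  g₀ g₁) (true ∷ t)  = cong (true ∷_) (apply-invᵀ-apply g₁ t)

apply-root-false : ∀ {k} (g : TreeAut (suc k)) → root g ≡ false →
  ∀ b t → apply g (b ∷ t) ≡ b ∷ apply (child g b) t
apply-root-false (node false _ _) refl false t = refl
apply-root-false (node false _ _) refl true  t = refl

apply²-root-true : ∀ {k} (g : TreeAut (suc k)) → root g ≡ true →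
  ∀ b t → apply g (apply g (b ∷ t)) ≡ b ∷ apply (child g (not b) ∘ᵀ child g b) t
apply²-root-true (node true g₀ g₁) refl false t = cong (false ∷_) (sym (apply-∘ᵀ g₁ g₀ t))
apply²-root-true (node true g₀ g₁) refl true  t = cong (true ∷_) (sym (apply-∘ᵀ g₀ g₁ t))

Balanced : ∀ {k} → TreeAut k → Set
Balanced leaf           = ⊤
Balanced (node _ g₀ g₁) = root g₀ ≡ root g₁ × Balanced g₀ × Balanced g₁

root-∘ᵀ : ∀ {k} (g f : TreeAut k) → root (g ∘ᵀ f) ≡ root f xor root g
root-∘ᵀ leaf         leaf             = refl
root-∘ᵀ (node _ _ _) (node false _ _) = refl
root-∘ᵀ (node _ _ _) (node true  _ _) = refl

root-invᵀ : ∀ {k} (g : TreeAut k) → root (invᵀ g) ≡ root g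
root-invᵀ leaf             = refl
root-invᵀ (node false _ _) = refl
root-invᵀ (node true  _ _) = refl

root-powᵀ-cong : ∀ {k} (g h : TreeAut k) → root g ≡ root h → ∀ c → root (powᵀ g c) ≡ root (powᵀ h c)
root-powᵀ-cong g h g≈h zero    = refl
root-powᵀ-cong g h g≈h (suc c) = begin
  root (g ∘ᵀ powᵀ g c)           ≡⟨ root-∘ᵀ g (powᵀ g c) ⟩
  root (powᵀ g c) xor root g     ≡⟨ cong₂ _xor_ (root-powᵀ-cong g h g≈h c) g≈h ⟩
  root (powᵀ h c) xor root h     ≡⟨ sym (root-∘ᵀ h (powᵀ h c)) ⟩
  root (h ∘ᵀ powᵀ h c)           ∎

root-zpowᵀ-cong : ∀ {k} (g h : TreeAut k) → root g ≡ root h → ∀ x → root (zpowᵀ g x) ≡ root (zpowᵀ h x)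
root-zpowᵀ-cong g h g≈h (+ c)    = root-powᵀ-cong g h g≈h c
root-zpowᵀ-cong g h g≈h -[1+ c ] =
  root-powᵀ-cong (invᵀ g) (invᵀ h) (trans (root-invᵀ g) (trans g≈h (sym (root-invᵀ h)))) (suc c)

balanced-child : ∀ {k} (g : TreeAut (suc k)) → Balanced g → ∀ b → Balanced (child g b)
balanced-child (node _ _ _) (_ , B₀ , _) false = B₀
balanced-child (node _ _ _) (_ , _ , B₁) true  = B₁

balanced-idᵀ : ∀ k → Balanced (idᵀ k)
balanced-idᵀ zero    = tt
balanced-idᵀ (suc k) = refl , balanced-idᵀ k , balanced-idᵀ k

balanced-∘ᵀ : ∀ {k} (g f : TreeAut k) → Balanced g → Balanced f → Balanced (g ∘ᵀ f)
balanced-∘ᵀ leaf leaf _ _ = tt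
balanced-∘ᵀ (node r g₀ g₁) (node false f₀ f₁) (g₀≈g₁ , G₀ , G₁) (f₀≈f₁ , F₀ , F₁) =
  trans (root-∘ᵀ g₀ f₀) (trans (cong₂ _xor_ f₀≈f₁ g₀≈g₁) (sym (root-∘ᵀ g₁ f₁))) ,
  balanced-∘ᵀ g₀ f₀ G₀ F₀ , balanced-∘ᵀ g₁ f₁ G₁ F₁
balanced-∘ᵀ (node r g₀ g₁) (node true f₀ f₁) (g₀≈g₁ , G₀ , G₁) (f₀≈f₁ , F₀ , F₁) =
  trans (root-∘ᵀ g₁ f₀) (trans (cong₂ _xor_ f₀≈f₁ (sym g₀≈g₁)) (sym (root-∘ᵀ g₀ f₁))) ,
  balanced-∘ᵀ g₁ f₀ G₁ F₀ , balanced-∘ᵀ g₀ f₁ G₀ F₁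

balanced-invᵀ : ∀ {k} (g : TreeAut k) → Balanced g → Balanced (invᵀ g)
balanced-invᵀ leaf _ = tt
balanced-invᵀ (node false g₀ g₁) (g₀≈g₁ , G₀ , G₁) =
  trans (root-invᵀ g₀) (trans g₀≈g₁ (sym (root-invᵀ g₁))) , balanced-invᵀ g₀ G₀ , balanced-invᵀ g₁ G₁
balanced-invᵀ (node true g₀ g₁) (g₀≈g₁ , G₀ , G₁) =
  trans (root-invᵀ g₁) (trans (sym g₀≈g₁) (sym (root-invᵀ g₀))) , balanced-invᵀ g₁ G₁ , balanced-invᵀ g₀ G₀

balanced-powᵀ : ∀ {k} (g : TreeAut k) → Balanced g → ∀ c → Balanced (powᵀ g c)
balanced-powᵀ {k} g G zero    = balanced-idᵀ k
balanced-powᵀ     g G (suc c) = balanced-∘ᵀ g (powᵀ g c) G (balanced-powᵀ g G c)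

balanced-zpowᵀ : ∀ {k} (g : TreeAut k) → Balanced g → ∀ x → Balanced (zpowᵀ g x)
balanced-zpowᵀ g G (+ c)    = balanced-powᵀ g G c
balanced-zpowᵀ g G -[1+ c ] = balanced-powᵀ (invᵀ g) (balanced-invᵀ g G) (suc c)

^-monoʳ-∣ : ∀ m {a b} → a ≤ b → m ^ a ℕ∣.∣ m ^ b
^-monoʳ-∣ m {a} a≤b with o , refl ← m≤n⇒∃[o]m+o≡n a≤b =
  subst (m ^ a ℕ∣.∣_) (sym (^-distribˡ-+-* m a o)) (ℕ∣.m∣m*n (m ^ o))

-- If the root label is true, g² fixes the first letter and, g being balanced, acts below it
-- with root label false; so the order doubles at most every second level.
balanced-order : ∀ {d} (g : TreeAut d) → Balanced g → ∀ t → iter (apply g) (2 ^ ⌈ d /2⌉) t ≡ t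
balanced-order leaf _ [] = refl
balanced-order {suc d} g@(node false _ _) G (b ∷ t) = begin
  iter (apply g) (2 ^ ⌈ suc d /2⌉) (b ∷ t)
    ≡⟨ iter-fix-head b (apply-root-false g refl b) (2 ^ ⌈ suc d /2⌉) t ⟩
  b ∷ iter (apply (child g b)) (2 ^ ⌈ suc d /2⌉) t
    ≡⟨ cong (b ∷_) (iter-∣ (balanced-order (child g b) (balanced-child g G b))
                           (^-monoʳ-∣ 2 (⌈n/2⌉-mono (n≤1+n d))) t) ⟩
  b ∷ t                                          ∎
balanced-order {suc zero} (node true leaf leaf) _ (false ∷ []) = refl
balanced-order {suc zero} (node true leaf leaf) _ (true ∷ [])  = refl
balanced-order {suc (suc d)} g@(node true _ _) G@(g₀≈g₁ , _ , _) (b ∷ c ∷ u) = begin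
  iter (apply g) (2 * M) (b ∷ c ∷ u)           ≡⟨ cong (λ e → iter (apply g) e (b ∷ c ∷ u)) (*-comm 2 M) ⟩
  iter (apply g) (M * 2) (b ∷ c ∷ u)           ≡⟨ iter-* (apply g) M 2 _ ⟩
  iter (iter (apply g) 2) M (b ∷ c ∷ u)        ≡⟨ iter-fix-head b (apply²-root-true g refl b) M _ ⟩
  b ∷ iter (apply h) M (c ∷ u)                 ≡⟨ cong (b ∷_) (iter-fix-head c (apply-root-false h h-root c) M u) ⟩
  b ∷ c ∷ iter (apply (child h c)) M u         ≡⟨ cong (λ v → b ∷ c ∷ v) (balanced-order (child h c) H u) ⟩
  b ∷ c ∷ u                                    ∎
  where
  M : ℕ
  M = 2 ^ ⌈ d /2⌉
  h : TreeAut (suc d)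
  h = child g (not b) ∘ᵀ child g b
  h-root : root h ≡ false
  h-root = trans (root-∘ᵀ (child g (not b)) (child g b))
                 (trans (cong (_xor root (child g (not b))) (sibling-roots b))
                        (xor-same (root (child g (not b)))))
    where
    sibling-roots : ∀ b → root (child g b) ≡ root (child g (not b))
    sibling-roots false = g₀≈g₁
    sibling-roots true  = sym g₀≈g₁
  H : Balanced (child h c)
  H = balanced-child h (balanced-∘ᵀ (child g (not b)) (child g b)
                                    (balanced-child g G (not b)) (balanced-child g G b)) c

-- The maps C as balanced tree automorphisms

module _ (m n : ℤ) where

  Cpow≗zpow : ∀ k z x t → Cpow m n k z x t ≡ zpow (C m n k z) (Cinv m n k z) x t
  Cpow≗zpow k z (+ c)    t = refl
  Cpow≗zpow k z -[1+ c ] t = refl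

  mutual
    C∘Cinv : ∀ k y t → C m n k y (Cinv m n k y t) ≡ t
    C∘Cinv zero    y []      = refl
    C∘Cinv (suc k) y (b ∷ t) = cong₂ _∷_ (not-involutive b) (Cpow∘Cpow-neg k (val m n (not b)) y t)

    Cinv∘C : ∀ k y t → Cinv m n k y (C m n k y t) ≡ t
    Cinv∘C zero    y []          = refl
    Cinv∘C (suc k) y (false ∷ t) = cong (false ∷_) (Cpow-neg∘Cpow k m y t)
    Cinv∘C (suc k) y (true ∷ t)  = cong (true ∷_) (Cpow-neg∘Cpow k n y t)

    Cpow∘Cpow-neg : ∀ k z x t → Cpow m n k z x (Cpow m n k z (- x) t) ≡ t
    Cpow∘Cpow-neg k z x t = begin
      Cpow m n k z x (Cpow m n k z (- x) t)  ≡⟨ Cpow≗zpow k z x _ ⟩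
      zpow Cz Cz⁻¹ x (Cpow m n k z (- x) t)  ≡⟨ cong (zpow Cz Cz⁻¹ x) (Cpow≗zpow k z (- x) t) ⟩
      zpow Cz Cz⁻¹ x (zpow Cz Cz⁻¹ (- x) t)  ≡⟨ zpow-cancel Cz Cz⁻¹ (C∘Cinv k z) (Cinv∘C k z) x t ⟩
      t                                      ∎
      where
      Cz Cz⁻¹ : Vec Bool k → Vec Bool k
      Cz   = C m n k z
      Cz⁻¹ = Cinv m n k z

    Cpow-neg∘Cpow : ∀ k z x t → Cpow m n k z (- x) (Cpow m n k z x t) ≡ t
    Cpow-neg∘Cpow k z x t =
      trans (cong (λ y → Cpow m n k z (- x) (Cpow m n k z y t)) (sym (neg-involutive x)))
            (Cpow∘Cpow-neg k z (- x) t)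

  portrait : ∀ k → ℤ → TreeAut k
  portrait zero    y = leaf
  portrait (suc k) y = node true (zpowᵀ (portrait k m) y) (zpowᵀ (portrait k n) y)

  apply-zpowᵀ : ∀ {k z} (P : TreeAut k) → (∀ t → apply P t ≡ C m n k z t) →
    ∀ x t → apply (zpowᵀ P x) t ≡ Cpow m n k z x t
  apply-zpowᵀ     P P≗C (+ c)    t = trans (apply-powᵀ P c t) (iter-cong P≗C c t)
  apply-zpowᵀ {k} {z} P P≗C -[1+ c ] t =
    trans (apply-powᵀ (invᵀ P) (suc c) t) (iter-cong P⁻¹≗Cinv (suc c) t)
    where
    P⁻¹≗Cinv : ∀ u → apply (invᵀ P) u ≡ Cinv m n k z u
    P⁻¹≗Cinv u = begin
      apply (invᵀ P) u                                   ≡⟨ cong (apply (invᵀ P)) (sym (C∘Cinv k z u)) ⟩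
      apply (invᵀ P) (C m n k z (Cinv m n k z u))        ≡⟨ cong (apply (invᵀ P)) (sym (P≗C _)) ⟩
      apply (invᵀ P) (apply P (Cinv m n k z u))          ≡⟨ apply-invᵀ-apply P _ ⟩
      Cinv m n k z u                                     ∎

  apply-portrait : ∀ k y t → apply (portrait k y) t ≡ C m n k y t
  apply-portrait zero    y []          = refl
  apply-portrait (suc k) y (false ∷ t) =
    cong (true ∷_) (apply-zpowᵀ (portrait k m) (apply-portrait k m) y t)
  apply-portrait (suc k) y (true ∷ t)  =
    cong (false ∷_) (apply-zpowᵀ (portrait k n) (apply-portrait k n) y t)

  balanced-portrait : ∀ k y → Balanced (portrait k y)
  balanced-portrait zero    y = tt
  balanced-portrait (suc k) y =
    root-zpowᵀ-cong (portrait k m) (portrait k n) (same-root k) y ,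
    balanced-zpowᵀ (portrait k m) (balanced-portrait k m) y ,
    balanced-zpowᵀ (portrait k n) (balanced-portrait k n) y
    where
    same-root : ∀ k → root (portrait k m) ≡ root (portrait k n)
    same-root zero    = refl
    same-root (suc k) = refl

  C-order : ∀ k y t → iter (C m n k y) (2 ^ ⌈ k /2⌉) t ≡ t
  C-order k y t = trans (sym (iter-cong (apply-portrait k y) (2 ^ ⌈ k /2⌉) t))
                        (balanced-order (portrait k y) (balanced-portrait k y) t)

  C-exponent-periodic : ∀ k {y y'} → + (2 ^ ⌈ k /2⌉) ∣ y' - y →
    ∀ t → C m n (suc k) y' t ≡ C m n (suc k) y t
  C-exponent-periodic k {y} {y'} d (b ∷ t) = cong (not b ∷_) (begin
    Cpow m n k z y' t         ≡⟨ Cpow≗zpow k z y' t ⟩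
    zpow Cz Cz⁻¹ y' t         ≡⟨ zpow-periodic Cz Cz⁻¹ (C∘Cinv k z) (C-order k z) {y} {y'} d t ⟩
    zpow Cz Cz⁻¹ y t          ≡⟨ Cpow≗zpow k z y t ⟨
    Cpow m n k z y t          ∎)
    where
    z : ℤ
    z = val m n b
    Cz Cz⁻¹ : Vec Bool k → Vec Bool k
    Cz   = C m n k z
    Cz⁻¹ = Cinv m n k z

-- Dependence on n

module _ {m n n' : ℤ} {k : ℕ} {z z' : ℤ} (C≗C' : ∀ w → C m n k z w ≡ C m n' k z' w) where

  Cinv-cong : ∀ u → Cinv m n k z u ≡ Cinv m n' k z' u
  Cinv-cong u = begin
    Cinv m n k z u                                  ≡⟨ Cinv∘C m n' k z' _ ⟨
    Cinv m n' k z' (C m n' k z' (Cinv m n k z u))   ≡⟨ cong (Cinv m n' k z') (C≗C' _) ⟨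
    Cinv m n' k z' (C m n k z (Cinv m n k z u))     ≡⟨ cong (Cinv m n' k z') (C∘Cinv m n k z u) ⟩
    Cinv m n' k z' u                                ∎

  Cpow-cong : ∀ x u → Cpow m n k z x u ≡ Cpow m n' k z' x u
  Cpow-cong (+ c)    u = iter-cong C≗C' c u
  Cpow-cong -[1+ c ] u = iter-cong Cinv-cong (suc c) u

2^⌊k/2⌋∣2^⌈k/2⌉ : ∀ k → 2 ^ ⌊ k /2⌋ ℕ∣.∣ 2 ^ ⌈ k /2⌉
2^⌊k/2⌋∣2^⌈k/2⌉ k = ^-monoʳ-∣ 2 (⌊n/2⌋≤⌈n/2⌉ k)

-- On length k + 2, n enters through the map C(n,-) on length k + 1, which depends on n only
-- modulo the order 2^⌈k/2⌉ = 2^⌊(k+1)/2⌋ of the maps on length k.  The divisibility _∣_ on ℤ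
-- is that of absolute values in ℕ, so ℕ's ∣-trans applies to it.
mutual
  C-periodic-in-n : ∀ k m {n n'} → + (2 ^ ⌊ k /2⌋) ∣ n' - n →
    ∀ x t → C m n (suc k) x t ≡ C m n' (suc k) x t
  C-periodic-in-n k m d x (b ∷ t) = cong (not b ∷_) (Cpow-cong (C-letter-periodic-in-n k m d b) x t)

  C-letter-periodic-in-n : ∀ k m {n n'} → + (2 ^ ⌊ k /2⌋) ∣ n' - n →
    ∀ b w → C m n k (val m n b) w ≡ C m n' k (val m n' b) w
  C-letter-periodic-in-n zero    m d b     [] = refl
  C-letter-periodic-in-n (suc k) m d false w =
    C-periodic-in-n k m (ℕ∣.∣-trans (2^⌊k/2⌋∣2^⌈k/2⌉ k) d) m w
  C-letter-periodic-in-n (suc k) m {n} {n'} d true w =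
    trans (C-periodic-in-n k m (ℕ∣.∣-trans (2^⌊k/2⌋∣2^⌈k/2⌉ k) d) n w)
          (sym (C-exponent-periodic m n' k d w))

⌊double-i/2⌋≡i : ∀ i → ⌊ double i /2⌋ ≡ i
⌊double-i/2⌋≡i zero    = refl
⌊double-i/2⌋≡i (suc i) = cong suc (⌊double-i/2⌋≡i i)

∣n-o⇒∣m-o⇒∣m-n : ∀ {d n m o} → d ∣ n - o → d ∣ m - o → d ∣ m - n
∣n-o⇒∣m-o⇒∣m-n {d} {n} {m} {o} d∣n-o d∣m-o =
  Signed.∣⇒∣ᵤ {d} {m - n} (subst (d Signed.∣_) (difference-of-differences m n o)
    (Signed.∣m∣n⇒∣m-n {d} {m - o} {n - o}
      (Signed.∣ᵤ⇒∣ {d} {m - o} d∣m-o) (Signed.∣ᵤ⇒∣ {d} {n - o} d∣n-o)))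
  where
  difference-of-differences : ∀ m n o → (m - o) - (n - o) ≡ m - n
  difference-of-differences = solve-∀

OrbitLength-cong : {A : Set} {f g : A → A} → (∀ a → f a ≡ g a) → ∀ {a p} →
  OrbitLength f a p ⇔ OrbitLength g a p
OrbitLength-cong {A} f≗g {a} {p} = mk⇔ (transport f≗g) (transport (λ a → sym (f≗g a)))
  where
  transport : {f g : A → A} → (∀ a → f a ≡ g a) → OrbitLength f a p → OrbitLength g a p
  transport f≗g (0<p , fᵖa≡a , minimal) =
    0<p , trans (sym (iter-cong f≗g p a)) fᵖa≡a ,
    λ q 0<q q<p g^q[a]≡a → minimal q 0<q q<p (trans (iter-cong f≗g q a) g^q[a]≡a)

C-congruent : ∀ i m {n₀ n n'} → + (2 ^ i) ∣ n - n₀ → + (2 ^ i) ∣ n' - n₀ →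
  ∀ x t → C m n (suc (double i)) x t ≡ C m n' (suc (double i)) x t
C-congruent i m {n₀} {n} {n'} d d' =
  C-periodic-in-n (double i) m (subst (λ e → + (2 ^ e) ∣ n' - n) (sym (⌊double-i/2⌋≡i i))
                                     (∣n-o⇒∣m-o⇒∣m-n {+ (2 ^ i)} {n} {n'} {n₀} d d'))

proposition4p1 : (j : ℕ) → 0 ℕ.< j → (n₀ : ℤ) → (+ 2) ∣ n₀ →
    (∀ (n n' : ℤ) → (+ 2) ∣ n → (+ (2 ℕ.^ (j ℕ.∸ 1))) ∣ (n - n₀) →
      (+ 2) ∣ n' → (+ (2 ℕ.^ (j ℕ.∸ 1))) ∣ (n' - n₀) →
      (OrbitLength (C (+ 1) n (ℕ.suc (double (j ℕ.∸ 1))) (+ 1)) (constM (j ℕ.∸ 1)) (2 ℕ.^ j)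
        ⇔ OrbitLength (C (+ 1) n' (ℕ.suc (double (j ℕ.∸ 1))) (+ 1)) (constM (j ℕ.∸ 1)) (2 ℕ.^ j)))
    × (∀ (n n' : ℤ) → (+ 2) ∣ n → (+ (2 ℕ.^ (j ℕ.∸ 1))) ∣ (n - n₀) →
      (+ 2) ∣ n' → (+ (2 ℕ.^ (j ℕ.∸ 1))) ∣ (n' - n₀) →
      (P j n ⇔ P j n'))
proposition4p1 j _ n₀ _ =
  (λ n n' _ d _ d' → OrbitLength-cong (C-congruent (j ℕ.∸ 1) (+ 1) d d' (+ 1))) ,
  (λ n n' _ d _ d' →
    let C≗C' = C-congruent (j ℕ.∸ 1) (- + 1) d d' (- + 1)
    in OrbitLength-cong C≗C' ×-⇔ OrbitLength-cong C≗C')
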